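{- For the directed path $P_n=(v_1,v_2,\dots,v_n)$ (arcs $v_iv_{i+1}$), $n\ge1$, $\gamma_{so}(P_n)=\lceil 3n/5\rceil$.
   Context: For a digraph $D=(V,A)$, $N^+(v)=\{w: vw\in A\}$, $N^-(v)=\{w: wv\in A\}$. $S\subseteq V$ is out-dominating if every $v\in V\setminus S$ has an in-neighbor in $S$. $S$ is a secure out-dominating set (SODS) if $S$ is out-dominating and for every $v\in V\setminus S$ there is $u\in(N^+(v)\cup N^-(v))\cap S$ such that $(S\setminus\{u\})\cup\{v\}$ is out-dominating; $\gamma_{so}(D)$ is the minimum size of an SODS. -}

module Defs where

open import Data.Nat using (ℕ; suc; _≤_; _*_; _+_; _/_)
open import Data.Fin using (Fin; toℕ)
open import Data.Fin.Subset using (Subset; _∈_; _∉_; _∪_; _-_; ⁅_⁆; ∣_∣)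
open import Data.Product using (Σ; ∃; _×_)
open import Data.Sum using (_⊎_)
open import Relation.Binary.PropositionalEquality using (_≡_)

-- A digraph on the vertex set Fin n, given by its arc relation:
-- Arc u v means uv ∈ A (an arc from u to v).
Digraph : ℕ → Set₁
Digraph n = Fin n → Fin n → Set

module _ {n : ℕ} (D : Digraph n) where

  OutDominating : Subset n → Set
  OutDominating S = ∀ v → v ∉ S → ∃ λ u → u ∈ S × D u v

  SecureOutDominating : Subset n → Set
  SecureOutDominating S =
    OutDominating S ×
    (∀ v → v ∉ S →
      ∃ λ u → (D v u ⊎ D u v) × u ∈ S × OutDominating ((S - u) ∪ ⁅ v ⁆))

  γso≡ : ℕ → Set
  γso≡ k =
    (∃ λ S → SecureOutDominating S × ∣ S ∣ ≡ k) ×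
    (∀ S → SecureOutDominating S → k ≤ ∣ S ∣)

-- The directed path P_n: vertices v_1..v_n are Fin n (v_i ↦ i-1), arcs v_i v_{i+1}.
DirPath : (n : ℕ) → Digraph n
DirPath n u v = suc (toℕ u) ≡ toℕ v

⌈_/5⌉ : ℕ → ℕ
⌈ m /5⌉ = (m + 4) / 5

module Submission where

-- Read a subset S of P_n as the bit string of its characteristic vector. On a
-- directed path S is a secure out-dominating set iff every vertex v_i ∉ S has
-- v_{i-1} ∈ S (it must be dominated) and, in addition, either v_{i-2} ∈ S (so
-- v_i can be swapped with v_{i-1}) or v_{i+1} ∈ S and v_{i+2} ∈ S whenever
-- v_{i+2} exists (so v_i can be swapped with v_{i+1}). Such a string keeps this
-- form after removing a leading 1 from a run of at least three ones, or a leading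
-- block 110, 101 (followed by 11) or 10110; every removed piece, and every short
-- string admitting no such removal, has at least 3/5 ones. Hence 3n ≤ 5|S|.
-- The string 10110 10110 … (with tail 11 when n ≡ 2 mod 5) attains the bound.

open import Data.Bool using (Bool; true; false; T)
open import Data.Bool.Properties using (¬-not)
open import Data.Empty using (⊥; ⊥-elim)
open import Data.Fin using (Fin; zero; suc; toℕ; fromℕ<; _≟_)
open import Data.Fin.Properties using (toℕ-fromℕ<; toℕ-injective; toℕ<n)
open import Data.Fin.Subset using (Subset; _∈_; _∉_; _∪_; _-_; ⁅_⁆; ∣_∣)
open import Data.Fin.Subset.Properties
  using (_∈?_; x∈p∪q⁻; x∈p∪q⁺; x∈⁅x⁆; x∈⁅y⁆⇒x≡y; x∈p∧x≢y⇒x∈p-y; p─q⊆p)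
open import Data.Nat using (ℕ; zero; suc; _+_; _*_; _≤_; _<_; _≥_; _≤ᵇ_; z≤n; s≤s; _/_)
open import Data.Nat.DivMod using (m<n*o⇒m/o<n; m/n≡1+[m∸n]/n)
open import Data.Nat.Properties
  using (≤-reflexive; <-irrefl; <-asym; suc-injective; ≤ᵇ⇒≤; ≤-pred;
         m≤m+n; +-monoˡ-≤; +-mono-≤; +-comm; *-comm; n<1+n; module ≤-Reasoning)
open import Data.Nat.Tactic.RingSolver using (solve-∀)
open import Data.Product using (∃; _×_; _,_; proj₁)
open import Data.Sum using (_⊎_; inj₁; inj₂)
open import Data.Unit using (⊤; tt)
open import Data.Vec using (Vec; []; _∷_)
open import Data.Vec.Base using (here; there)
open import Function using (_∘_)
open import Relation.Binary.PropositionalEquality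
  using (_≡_; _≢_; refl; sym; trans; cong; subst; module ≡-Reasoning)
open import Relation.Nullary using (¬_; yes; no)

open import Defs

private variable
  n i : ℕ
  a b : Bool
  S : Subset n
  u v w x : Fin n

bit : Vec Bool n → ℕ → Bool
bit []      _       = false
bit (x ∷ S) zero    = x
bit (x ∷ S) (suc i) = bit S i

∈⇒bit : x ∈ S → bit S (toℕ x) ≡ true
∈⇒bit here      = refl
∈⇒bit (there p) = ∈⇒bit p

bit⇒∈ : (x : Fin n) → bit S (toℕ x) ≡ true → x ∈ S
bit⇒∈ {S = _ ∷ _} zero    refl = here
bit⇒∈ {S = _ ∷ _} (suc x) e    = there (bit⇒∈ x e)

∉⇒bit : x ∉ S → bit S (toℕ x) ≡ false
∉⇒bit x∉S = ¬-not (x∉S ∘ bit⇒∈ _)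

bit⇒∉ : bit S (toℕ x) ≡ false → x ∉ S
bit⇒∉ e x∈S with () ← trans (sym e) (∈⇒bit x∈S)

member : bit S i ≡ true → ∃ λ x → x ∈ S × toℕ x ≡ i
member {S = _ ∷ _} {i = zero}  e = zero , bit⇒∈ zero e , refl
member {S = _ ∷ _} {i = suc i} e with member {i = i} e
... | x , x∈S , toℕx = suc x , there x∈S , cong suc toℕx

predecessor : bit (false ∷ S) i ≡ true → ∃ λ x → x ∈ S × suc (toℕ x) ≡ i
predecessor {i = suc i} e with member {i = i} e
... | x , x∈S , toℕx = x , x∈S , cong suc toℕx

x∉p-x : (x : Fin n) → x ∉ S - x
x∉p-x {S = _ ∷ _} zero    ()
x∉p-x {S = _ ∷ _} (suc x) (there p) = x∉p-x x p

∈-swap⁻ : x ∈ (S - u) ∪ ⁅ v ⁆ → x ≡ v ⊎ (x ∈ S × x ≢ u)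
∈-swap⁻ {S = S} {u} {v} x∈S′ with x∈p∪q⁻ (S - u) ⁅ v ⁆ x∈S′
... | inj₂ x∈⁅v⁆ = inj₁ (x∈⁅y⁆⇒x≡y v x∈⁅v⁆)
... | inj₁ x∈S-u = inj₂ (p─q⊆p S ⁅ u ⁆ x∈S-u , λ { refl → x∉p-x u x∈S-u })

∈-swap⁺ : x ∈ S → x ≢ u → x ∈ (S - u) ∪ ⁅ v ⁆
∈-swap⁺ x∈S x≢u = x∈p∪q⁺ (inj₁ (x∈p∧x≢y⇒x∈p-y x∈S x≢u))

v∈swap : v ∈ (S - u) ∪ ⁅ v ⁆
v∈swap {v = v} = x∈p∪q⁺ (inj₂ (x∈⁅x⁆ v))

∉-swap : w ∉ S → w ≢ v → w ∉ (S - u) ∪ ⁅ v ⁆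
∉-swap w∉S w≢v w∈S′ with ∈-swap⁻ w∈S′
... | inj₁ w≡v        = w≢v w≡v
... | inj₂ (w∈S , _) = w∉S w∈S

u∉swap : u ≢ v → u ∉ (S - u) ∪ ⁅ v ⁆
u∉swap u≢v u∈S′ with ∈-swap⁻ u∈S′
... | inj₁ u≡v        = u≢v u≡v
... | inj₂ (_ , u≢u) = u≢u refl

swap-outDominating : {D : Digraph n} → OutDominating D S →
  (∃ λ x → x ∈ (S - u) ∪ ⁅ v ⁆ × D x u) → (∀ w → D u w → w ≢ v → w ∈ S) →
  OutDominating D ((S - u) ∪ ⁅ v ⁆)
swap-outDominating {u = u} {v} od dominated-u out-u w w∉S′ with w ≟ u
... | yes refl = dominated-u
... | no w≢u with od w (λ w∈S → w∉S′ (∈-swap⁺ w∈S w≢u))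
...   | x , x∈S , xw with x ≟ u
...     | no x≢u   = x , ∈-swap⁺ x∈S x≢u , xw
...     | yes refl = ⊥-elim (w∉S′ (∈-swap⁺ (out-u w xw w≢v) w≢u))
  where
  w≢v : w ≢ v
  w≢v refl = w∉S′ v∈swap

arc⇒< : DirPath n u v → toℕ u < toℕ v
arc⇒< = ≤-reflexive

arc-irreflexive : DirPath n u v → u ≢ v
arc-irreflexive uv refl = <-irrefl refl (arc⇒< uv)

arc-asymmetric : DirPath n u v → ¬ DirPath n v u
arc-asymmetric uv vu = <-asym (arc⇒< uv) (arc⇒< vu)

in-neighbour-unique : DirPath n x w → DirPath n u w → x ≡ u
in-neighbour-unique xw uw = toℕ-injective (suc-injective (trans xw (sym uw)))

out-neighbour-unique : DirPath n u w → DirPath n u v → w ≡ v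
out-neighbour-unique uw uv = toℕ-injective (trans (sym uw) uv)

RightSupported : Vec Bool n → Set
RightSupported (true ∷ [])       = ⊤
RightSupported (true ∷ true ∷ _) = ⊤
RightSupported _                 = ⊥

RightSupportedAt : Vec Bool n → ℕ → Set
RightSupportedAt []      _       = ⊥
RightSupportedAt (_ ∷ S) zero    = RightSupported S
RightSupportedAt (_ ∷ S) (suc i) = RightSupportedAt S i

-- A vertex outside S whose two predecessors carry the bits a and b is dominated,
-- and it can be swapped with its predecessor or, if R holds, with its successor.
Supported : Bool → Bool → Set → Set
Supported a b R = b ≡ true × (a ≡ true ⊎ R)

-- a and b are the bits of the two positions before S; for S the whole path they
-- lie off the path and are false.
SecureAfter : Bool → Bool → Vec Bool n → Set
SecureAfter a b []      = ⊤
SecureAfter a b (x ∷ S) = (x ≡ false → Supported a b (RightSupported S)) × SecureAfter b x S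

SupportedAt : Bool → Bool → Vec Bool n → ℕ → Set
SupportedAt a b S i =
  Supported (bit (a ∷ b ∷ S) i) (bit (a ∷ b ∷ S) (suc i)) (RightSupportedAt S i)

ZerosSupported : Bool → Bool → Vec Bool n → Set
ZerosSupported {n} a b S = ∀ i → i < n → bit S i ≡ false → SupportedAt a b S i

secureAfter⇒zerosSupported : SecureAfter a b S → ZerosSupported a b S
secureAfter⇒zerosSupported {S = _ ∷ _} (z , _) zero    _         = z
secureAfter⇒zerosSupported {S = _ ∷ _} (_ , s) (suc i) (s≤s i<n) =
  secureAfter⇒zerosSupported s i i<n

zerosSupported⇒secureAfter : ZerosSupported a b S → SecureAfter a b S
zerosSupported⇒secureAfter {S = []}    _ = tt
zerosSupported⇒secureAfter {S = _ ∷ _} h =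
  h 0 (s≤s z≤n) , zerosSupported⇒secureAfter (λ i i<n → h (suc i) (s≤s i<n))

secureAfter-false : SecureAfter a false S → SecureAfter b false S
secureAfter-false {S = []}    _       = tt
secureAfter-false {S = _ ∷ _} (z , s) = (λ e → ⊥-elim (unsupported (z e))) , s
  where
  unsupported : ∀ {R} → ¬ Supported a false R
  unsupported (() , _)

rightSupportedAt⁺ : {S : Vec Bool n} → bit S (suc i) ≡ true →
  (suc (suc i) < n → bit S (suc (suc i)) ≡ true) → RightSupportedAt S i
rightSupportedAt⁺ {i = zero}  {S = _ ∷ true ∷ []}    refl _ = tt
rightSupportedAt⁺ {i = zero}  {S = _ ∷ true ∷ _ ∷ _} refl h with h (s≤s (s≤s (s≤s z≤n)))
... | refl = tt
rightSupportedAt⁺ {i = suc i} {S = _ ∷ S}            e    h = rightSupportedAt⁺ {S = S} e (h ∘ s≤s)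

rightSupportedAt⁻ : {S : Vec Bool n} → RightSupportedAt S i →
  bit S (suc i) ≡ true × (suc (suc i) < n → bit S (suc (suc i)) ≡ true)
rightSupportedAt⁻ {i = zero}  {S = _ ∷ true ∷ []}        _ = refl , λ { (s≤s (s≤s ())) }
rightSupportedAt⁻ {i = zero}  {S = _ ∷ true ∷ true ∷ _}  _ = refl , λ _ → refl
rightSupportedAt⁻ {i = zero}  {S = _ ∷ true ∷ false ∷ _} ()
rightSupportedAt⁻ {i = zero}  {S = _ ∷ false ∷ _}        ()
rightSupportedAt⁻ {i = suc i} {S = _ ∷ S}                r with rightSupportedAt⁻ {S = S} r
... | next , after = next , λ { (s≤s lt) → after lt }

SwapPartner : Digraph n → Subset n → Fin n → Set
SwapPartner D S v = ∃ λ u → (D v u ⊎ D u v) × u ∈ S × OutDominating D ((S - u) ∪ ⁅ v ⁆)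

sods⇒supportedAt : {S : Subset n} → SecureOutDominating (DirPath n) S →
  (v : Fin n) → v ∉ S → SupportedAt false false S (toℕ v)
sods⇒supportedAt {n} {S} (od , secure) v v∉S = dominated (od v v∉S) , swappable (secure v v∉S)
  where
  dominated : (∃ λ u → u ∈ S × DirPath n u v) → bit (false ∷ S) (toℕ v) ≡ true
  dominated (u , u∈S , uv) = trans (cong (bit (false ∷ S)) (sym uv)) (∈⇒bit u∈S)

  swappable : SwapPartner (DirPath n) S v →
              bit (false ∷ false ∷ S) (toℕ v) ≡ true ⊎ RightSupportedAt S (toℕ v)
  swappable (u , inj₂ uv , _ , od′) with od′ u (u∉swap (arc-irreflexive uv))
  ... | x , x∈S′ , xu with ∈-swap⁻ x∈S′
  ...   | inj₁ refl       = ⊥-elim (arc-asymmetric uv xu)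
  ...   | inj₂ (x∈S , _) =
    inj₁ (trans (cong (bit (false ∷ false ∷ S)) (sym (trans (cong suc xu) uv))) (∈⇒bit x∈S))
  swappable (u , inj₁ vu , u∈S , od′) =
    inj₂ (rightSupportedAt⁺ {i = toℕ v} {S = S} (trans (cong (bit S) vu) (∈⇒bit u∈S)) after)
    where
    -- y ∉ S would leave y undominated in the swapped set: its only in-neighbour is u.
    out-u : ∀ y → DirPath n u y → y ∈ S
    out-u y uy with y ∈? S
    ... | yes y∈S = y∈S
    ... | no y∉S with od′ y (∉-swap y∉S (arc-asymmetric vu ∘ λ y≡v → subst (DirPath n u) y≡v uy))
    ...   | x , x∈S′ , xy =
      ⊥-elim (u∉swap (arc-irreflexive vu ∘ sym)
                     (subst (_∈ (S - u) ∪ ⁅ v ⁆) (in-neighbour-unique xy uy) x∈S′))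

    after : suc (suc (toℕ v)) < n → bit S (suc (suc (toℕ v))) ≡ true
    after lt = trans (cong (bit S) (sym (toℕ-fromℕ< lt)))
      (∈⇒bit (out-u (fromℕ< lt) (trans (cong suc (sym vu)) (sym (toℕ-fromℕ< lt)))))

sods⇒secure : {S : Subset n} → SecureOutDominating (DirPath n) S → SecureAfter false false S
sods⇒secure {S = S} sods = zerosSupported⇒secureAfter λ i i<n e →
  subst (SupportedAt false false S) (toℕ-fromℕ< i<n)
    (sods⇒supportedAt sods (fromℕ< i<n) (bit⇒∉ (trans (cong (bit S) (toℕ-fromℕ< i<n)) e)))

secure⇒sods : {S : Subset n} → SecureAfter false false S → SecureOutDominating (DirPath n) S
secure⇒sods {n} {S} s = od , partner
  where
  supported : ∀ v → v ∉ S → SupportedAt false false S (toℕ v)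
  supported v v∉S = secureAfter⇒zerosSupported s (toℕ v) (toℕ<n v) (∉⇒bit v∉S)

  od : OutDominating (DirPath n) S
  od v v∉S = predecessor (proj₁ (supported v v∉S))

  partner-before : ∀ v → bit (false ∷ S) (toℕ v) ≡ true →
    bit (false ∷ false ∷ S) (toℕ v) ≡ true → SwapPartner (DirPath n) S v
  partner-before v dominated left with predecessor dominated
  ... | u , u∈S , uv with predecessor (trans (cong (bit (false ∷ false ∷ S)) uv) left)
  ...   | x , x∈S , xu =
    u , inj₂ uv , u∈S ,
    swap-outDominating od (x , ∈-swap⁺ x∈S (arc-irreflexive xu) , xu)
      (λ w uw w≢v → ⊥-elim (w≢v (out-neighbour-unique uw uv)))

  partner-after : ∀ v → RightSupportedAt S (toℕ v) → SwapPartner (DirPath n) S v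
  partner-after v right with rightSupportedAt⁻ {S = S} right
  ... | next , after with member next
  ...   | u , u∈S , toℕu =
    u , inj₁ (sym toℕu) , u∈S , swap-outDominating od (v , v∈swap , sym toℕu) out-u
    where
    out-u : ∀ w → DirPath n u w → w ≢ v → w ∈ S
    out-u w uw _ = bit⇒∈ w (trans (cong (bit S) (sym toℕw)) (after (subst (_< n) (sym toℕw) (toℕ<n w))))
      where
      toℕw : suc (suc (toℕ v)) ≡ toℕ w
      toℕw = trans (cong suc (sym toℕu)) uw

  partner : ∀ v → v ∉ S → SwapPartner (DirPath n) S v
  partner v v∉S with supported v v∉S
  ... | dominated , inj₁ left  = partner-before v dominated left
  ... | _         , inj₂ right = partner-after v right

extend : ∀ m k {x y} → T (m ≤ᵇ k) → x ≤ y → m + x ≤ k + y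
extend m k m≤k = +-mono-≤ (≤ᵇ⇒≤ m k m≤k)

secure⇒n*3≤∣S∣*5 : (S : Subset n) → SecureAfter false false S → n * 3 ≤ ∣ S ∣ * 5
secure⇒n*3≤∣S∣*5 []                  _ = z≤n
secure⇒n*3≤∣S∣*5 (false ∷ _)         (z , _) with z refl
... | () , _
secure⇒n*3≤∣S∣*5 (true ∷ [])         _ = ≤ᵇ⇒≤ _ _ tt
secure⇒n*3≤∣S∣*5 (true ∷ true ∷ [])  _ = ≤ᵇ⇒≤ _ _ tt
secure⇒n*3≤∣S∣*5 (true ∷ S@(true ∷ true ∷ _)) (_ , _ , _ , s) =
  extend 3 5 tt (secure⇒n*3≤∣S∣*5 S ((λ ()) , (λ ()) , s))
secure⇒n*3≤∣S∣*5 (true ∷ true ∷ false ∷ S) (_ , _ , _ , s) =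
  extend 9 10 tt (secure⇒n*3≤∣S∣*5 S (secureAfter-false s))
secure⇒n*3≤∣S∣*5 (true ∷ false ∷ [])        (_ , z , _) with z refl
... | _ , inj₁ ()
... | _ , inj₂ ()
secure⇒n*3≤∣S∣*5 (true ∷ false ∷ false ∷ _) (_ , _ , z , _) with z refl
... | () , _
secure⇒n*3≤∣S∣*5 (true ∷ false ∷ true ∷ []) _ = ≤ᵇ⇒≤ _ _ tt
secure⇒n*3≤∣S∣*5 (true ∷ false ∷ true ∷ false ∷ _) (_ , z , _) with z refl
... | _ , inj₁ ()
... | _ , inj₂ ()
secure⇒n*3≤∣S∣*5 (true ∷ false ∷ true ∷ true ∷ []) _ = ≤ᵇ⇒≤ _ _ tt
secure⇒n*3≤∣S∣*5 (true ∷ false ∷ true ∷ S@(true ∷ true ∷ _)) (_ , _ , _ , _ , _ , s) =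
  extend 9 10 tt (secure⇒n*3≤∣S∣*5 S ((λ ()) , (λ ()) , s))
secure⇒n*3≤∣S∣*5 (true ∷ false ∷ true ∷ true ∷ false ∷ S) (_ , _ , _ , _ , _ , s) =
  extend 15 15 tt (secure⇒n*3≤∣S∣*5 S (secureAfter-false s))

⌈/5⌉-least : ∀ {m c} → m ≤ c * 5 → ⌈ m /5⌉ ≤ c
⌈/5⌉-least {m} {c} m≤c*5 = ≤-pred (m<n*o⇒m/o<n (begin-strict
  m + 4           ≤⟨ +-monoˡ-≤ 4 m≤c*5 ⟩
  c * 5 + 4       <⟨ n<1+n _ ⟩
  suc (c * 5 + 4) ≡⟨ cong suc (+-comm (c * 5) 4) ⟩
  suc c * 5       ∎))
  where open ≤-Reasoning

repeat10110 : (n : ℕ) → Subset n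
repeat10110 0 = []
repeat10110 1 = true ∷ []
repeat10110 2 = true ∷ true ∷ []
repeat10110 3 = true ∷ false ∷ true ∷ []
repeat10110 4 = true ∷ false ∷ true ∷ true ∷ []
repeat10110 (suc (suc (suc (suc (suc n))))) = true ∷ false ∷ true ∷ true ∷ false ∷ repeat10110 n

repeat10110-secure : ∀ n → SecureAfter false false (repeat10110 n)
repeat10110-secure 0 = tt
repeat10110-secure 1 = (λ ()) , tt
repeat10110-secure 2 = (λ ()) , (λ ()) , tt
repeat10110-secure 3 = (λ ()) , (λ _ → refl , inj₂ tt) , (λ ()) , tt
repeat10110-secure 4 = (λ ()) , (λ _ → refl , inj₂ tt) , (λ ()) , (λ ()) , tt
repeat10110-secure (suc (suc (suc (suc (suc n))))) =
  (λ ()) , (λ _ → refl , inj₂ tt) , (λ ()) , (λ ()) , (λ _ → refl , inj₁ refl) ,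
  secureAfter-false (repeat10110-secure n)

⌈5+m/5⌉≡1+⌈m/5⌉ : ∀ m → ⌈ 5 + m /5⌉ ≡ suc ⌈ m /5⌉
⌈5+m/5⌉≡1+⌈m/5⌉ m = m/n≡1+[m∸n]/n (m≤m+n 5 (m + 4))

∣repeat10110∣ : ∀ n → ∣ repeat10110 n ∣ ≡ ⌈ 3 * n /5⌉
∣repeat10110∣ 0 = refl
∣repeat10110∣ 1 = refl
∣repeat10110∣ 2 = refl
∣repeat10110∣ 3 = refl
∣repeat10110∣ 4 = refl
∣repeat10110∣ (suc (suc (suc (suc (suc n))))) = sym (begin
  ⌈ 3 * (5 + n) /5⌉             ≡⟨ cong ⌈_/5⌉ (lemma n) ⟩
  ⌈ 5 + (5 + (5 + 3 * n)) /5⌉   ≡⟨ ⌈5+m/5⌉≡1+⌈m/5⌉ (5 + (5 + 3 * n)) ⟩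
  suc ⌈ 5 + (5 + 3 * n) /5⌉     ≡⟨ cong suc (⌈5+m/5⌉≡1+⌈m/5⌉ (5 + 3 * n)) ⟩
  2 + ⌈ 5 + 3 * n /5⌉           ≡⟨ cong (2 +_) (⌈5+m/5⌉≡1+⌈m/5⌉ (3 * n)) ⟩
  3 + ⌈ 3 * n /5⌉               ≡⟨ cong (3 +_) (∣repeat10110∣ n) ⟨
  3 + ∣ repeat10110 n ∣         ∎)
  where
  open ≡-Reasoning
  lemma : ∀ n → 3 * (5 + n) ≡ 5 + (5 + (5 + 3 * n))
  lemma = solve-∀

proposition4p7 : (n : ℕ) → n ≥ 1 → γso≡ (DirPath n) ⌈ 3 * n /5⌉
proposition4p7 n _ =
  (repeat10110 n , secure⇒sods (repeat10110-secure n) , ∣repeat10110∣ n) ,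
  λ S sods → ⌈/5⌉-least (subst (_≤ ∣ S ∣ * 5) (*-comm n 3) (secure⇒n*3≤∣S∣*5 S (sods⇒secure sods)))
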